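{- Let $S$ be any cirquent calculus system (i.e. any subset of the eight rules A, M, E, W, D, C, $\vee$, $\wedge$). If $S$ proves a cirquent $C$, then $S$ also proves every substitutional instance of $C$.
   Context: Formulas: built from propositional atoms using $\neg,\wedge,\vee$ (binary), with $\neg$ only on atoms; $\neg\neg F$, $\neg(F\wedge G)$, $\neg(F\vee G)$ abbreviate $F$, $\neg F\vee\neg G$, $\neg F\wedge\neg G$. A $k$-ary cirquent is a pair consisting of a structure (a finite sequence, repetitions allowed, of subsets of $\{1,\dots,k\}$, called ogroups) and a pool $\langle F_1,\dots,F_k\rangle$ of formulas (oformulas); ogroup $\Gamma$ contains $F_i$ for $i\in\Gamma$. The rules: (A) Axioms: the empty cirquent and $(\langle\{1,2\}\rangle,\langle\neg F,F\rangle)$ for any formula $F$. (M) Mix: from $(\langle\Gamma_1..\Gamma_m\rangle,\langle F_1..F_k\rangle)$ and $(\langle\Delta_1..\Delta_n\rangle,\langle G_1..G_l\rangle)$ infer $(\langle\Gamma_1,..,\Gamma_m,\Delta_1+k,..,\Delta_n+k\rangle,\langle F_1,..,F_k,G_1,..,G_l\rangle)$, $\Delta+k=\{j+k:j\in\Delta\}$. (E) Exchange: swap two adjacent oformulas (ogroups keeping the same oformulas) or two adjacent ogroups. (W) Weakening: add to an ogroup the index of an existing oformula; or insert a new formula anywhere in the pool. (D) Duplication: replace an ogroup $\Gamma$ by adjacent $\Gamma,\Gamma$, or the reverse. (C) Contraction: merge two adjacent oformulas that are the same formula into one, contained in all ogroups that contained either. ($\vee$) Merge adjacent oformulas $F,G$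 into $F\vee G$, contained in exactly the ogroups that contained $F$ or $G$. ($\wedge$) When for adjacent oformulas $F,G$ no ogroup contains both, every ogroup containing $F$ is immediately followed by one containing $G$, and every ogroup containing $G$ is immediately preceded by one containing $F$: replace each such pair of adjacent ogroups by their union, then merge $F,G$ into $F\wedge G$. A proof in $S$ is a finite tree of cirquents each node of which follows from its children by a rule of $S$. A substitution $\sigma$ maps each atom to a formula and extends by $\sigma(\neg P)=\neg\sigma(P)$, $\sigma(F\wedge G)=\sigma(F)\wedge\sigma(G)$, $\sigma(F\vee G)=\sigma(F)\vee\sigma(G)$; $\sigma(C)$ replaces every oformula $F$ of cirquent $C$ by $\sigma(F)$, keeping the structure. $B$ is an instance of $A$ iff $B=\sigma(A)$ for some substitution $\sigma$. -}

module Defs where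

open import Data.Nat using (ℕ; zero; suc; _+_)
open import Data.Bool using (Bool; true; false; _∨_)
open import Data.Fin using (Fin; toℕ)
open import Data.Vec using (Vec; []; _∷_; _++_; replicate; map; _[_]≔_)
open import Data.List as L using (List; length; lookup)
open import Data.Fin.Subset using (Subset; _∪_)
open import Data.Product using (Σ; _×_)
open import Relation.Binary.PropositionalEquality using (_≡_)
open import Relation.Nullary using (¬_)

infixr 6 _∧ᶠ_
infixr 5 _∨ᶠ_

data Formula : Set where
  atom  : ℕ → Formula
  natom : ℕ → Formula
  _∧ᶠ_  : Formula → Formula → Formula
  _∨ᶠ_  : Formula → Formula → Formula

¬ᶠ : Formula → Formula
¬ᶠ (atom P)  = natom P
¬ᶠ (natom P) = atom P
¬ᶠ (F ∧ᶠ G)  = ¬ᶠ F ∨ᶠ ¬ᶠ G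
¬ᶠ (F ∨ᶠ G)  = ¬ᶠ F ∧ᶠ ¬ᶠ G

Substitution : Set
Substitution = ℕ → Formula

subF : Substitution → Formula → Formula
subF σ (atom P)  = σ P
subF σ (natom P) = ¬ᶠ (σ P)
subF σ (F ∧ᶠ G)  = subF σ F ∧ᶠ subF σ G
subF σ (F ∨ᶠ G)  = subF σ F ∨ᶠ subF σ G

-- Cirquents: k oformulas (the pool), and a finite sequence of ogroups,
-- each a subset of {1..k} (as a Data.Fin.Subset, i.e. characteristic vector).

record Cirquent : Set where
  constructor cirq
  field
    k      : ℕ
    struct : List (Subset k)
    pool   : Vec Formula k
open Cirquent public

subC : Substitution → Cirquent → Cirquent
subC σ (cirq k Γs pool) = cirq k Γs (map (subF σ) pool)

swapAt : ∀ {A : Set} {n} (m : ℕ) → Vec A (m + suc (suc n)) → Vec A (m + suc (suc n))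
swapAt zero    (x ∷ y ∷ v) = y ∷ x ∷ v
swapAt (suc m) (x ∷ v)     = x ∷ swapAt m v

mergeAt : ∀ {A : Set} {n} (f : A → A → A) (m : ℕ) → Vec A (m + suc (suc n)) → Vec A (m + suc n)
mergeAt f zero    (x ∷ y ∷ v) = f x y ∷ v
mergeAt f (suc m) (x ∷ v)     = x ∷ mergeAt f m v

insertAt : ∀ {A : Set} {n} (m : ℕ) → A → Vec A (m + n) → Vec A (m + suc n)
insertAt zero    a v       = a ∷ v
insertAt (suc m) a (x ∷ v) = x ∷ insertAt m a v

fstAt : ∀ {A : Set} {n} (m : ℕ) → Vec A (m + suc (suc n)) → A
fstAt zero    (x ∷ y ∷ v) = x
fstAt (suc m) (x ∷ v)     = fstAt m v

sndAt : ∀ {A : Set} {n} (m : ℕ) → Vec A (m + suc (suc n)) → A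
sndAt zero    (x ∷ y ∷ v) = y
sndAt (suc m) (x ∷ v)     = sndAt m v

-- The (∧) rule on structures: F is oformula m, G is oformula m+1.

record AndCond {n} (m : ℕ) (Γs : List (Subset (m + suc (suc n)))) : Set where
  field
    noBoth   : ∀ (i : Fin (length Γs)) →
               ¬ (fstAt m (lookup Γs i) ≡ true × sndAt m (lookup Γs i) ≡ true)
    followed : ∀ (i : Fin (length Γs)) → fstAt m (lookup Γs i) ≡ true →
               Σ (Fin (length Γs)) λ j → toℕ j ≡ suc (toℕ i) × sndAt m (lookup Γs j) ≡ true
    preceded : ∀ (j : Fin (length Γs)) → sndAt m (lookup Γs j) ≡ true →
               Σ (Fin (length Γs)) λ i → suc (toℕ i) ≡ toℕ j × fstAt m (lookup Γs i) ≡ true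

-- Replace each pair (ogroup containing F, next ogroup containing G) by the
-- union, and merge oformulas m, m+1 in all ogroups (membership = F or G).
mutual
  andStruct : ∀ {n} (m : ℕ) → List (Subset (m + suc (suc n))) → List (Subset (m + suc n))
  andStruct m L.[]         = L.[]
  andStruct m (Γ L.∷ Γs)   = andStructFrom m Γ Γs

  andStructFrom : ∀ {n} (m : ℕ) → Subset (m + suc (suc n)) → List (Subset (m + suc (suc n))) →
                  List (Subset (m + suc n))
  andStructFrom m Γ L.[] = mergeAt _∨_ m Γ L.∷ L.[]
  andStructFrom m Γ (Δ L.∷ Γs) with fstAt m Γ
  ... | true  = mergeAt _∨_ m (Γ ∪ Δ) L.∷ andStruct m Γs
  ... | false = mergeAt _∨_ m Γ L.∷ andStructFrom m Δ Γs

data Rule : Set where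
  A M E W D C ∨R ∧R : Rule

data Proves (S : Rule → Set) : (k : ℕ) → List (Subset k) → Vec Formula k → Set where
  axEmpty : S A → Proves S (0) (L.[]) ([])
  axLEM   : S A → ∀ F → Proves S (2) ((true ∷ true ∷ []) L.∷ L.[]) ((¬ᶠ F ∷ F ∷ []))
  mix : S M → ∀ {k l Γs Δs Fs Gs} → Proves S (k) (Γs) (Fs) → Proves S (l) (Δs) (Gs) →
        Proves S (k + l) (L.map (λ Γ → Γ ++ replicate l false) Γs
                    L.++ L.map (λ Δ → replicate k false ++ Δ) Δs) (Fs ++ Gs)
  exchF : S E → ∀ {n} m {Γs} (xs : Vec Formula m) F G (ys : Vec Formula n) →
          Proves S (m + suc (suc n)) (Γs) (xs ++ (F ∷ G ∷ ys)) →
          Proves S (m + suc (suc n)) (L.map (swapAt m) Γs) (xs ++ (G ∷ F ∷ ys))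
  exchG : S E → ∀ {k} Γs Γ Δ Δs {Fs} →
          Proves S (k) (Γs L.++ Γ L.∷ Δ L.∷ Δs) (Fs) →
          Proves S (k) (Γs L.++ Δ L.∷ Γ L.∷ Δs) (Fs)
  weakG : S W → ∀ {k} Γs Γ Δs (i : Fin k) {Fs} →
          Proves S (k) (Γs L.++ Γ L.∷ Δs) (Fs) →
          Proves S (k) (Γs L.++ (Γ [ i ]≔ true) L.∷ Δs) (Fs)
  weakF : S W → ∀ {n} m {Γs} (xs : Vec Formula m) H (ys : Vec Formula n) →
          Proves S (m + n) (Γs) (xs ++ ys) →
          Proves S (m + suc n) (L.map (insertAt m false) Γs) (xs ++ (H ∷ ys))
  dup   : S D → ∀ {k} Γs Γ Δs {Fs} →
          Proves S (k) (Γs L.++ Γ L.∷ Δs) (Fs) →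
          Proves S (k) (Γs L.++ Γ L.∷ Γ L.∷ Δs) (Fs)
  undup : S D → ∀ {k} Γs Γ Δs {Fs} →
          Proves S (k) (Γs L.++ Γ L.∷ Γ L.∷ Δs) (Fs) →
          Proves S (k) (Γs L.++ Γ L.∷ Δs) (Fs)
  contr : S C → ∀ {n} m {Γs} (xs : Vec Formula m) F (ys : Vec Formula n) →
          Proves S (m + suc (suc n)) (Γs) (xs ++ (F ∷ F ∷ ys)) →
          Proves S (m + suc n) (L.map (mergeAt _∨_ m) Γs) (xs ++ (F ∷ ys))
  orR : S ∨R → ∀ {n} m {Γs} (xs : Vec Formula m) F G (ys : Vec Formula n) →
        Proves S (m + suc (suc n)) (Γs) (xs ++ (F ∷ G ∷ ys)) →
        Proves S (m + suc n) (L.map (mergeAt _∨_ m) Γs) (xs ++ ((F ∨ᶠ G) ∷ ys))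
  andR : S ∧R → ∀ {n} m {Γs} (xs : Vec Formula m) F G (ys : Vec Formula n) →
         AndCond m Γs →
         Proves S (m + suc (suc n)) (Γs) (xs ++ (F ∷ G ∷ ys)) →
         Proves S (m + suc n) (andStruct m Γs) (xs ++ ((F ∧ᶠ G) ∷ ys))

Provable : (Rule → Set) → Cirquent → Set
Provable S (cirq k Γs pool) = Proves S k Γs pool

{-# OPTIONS --safe #-}
-- No rule inspects the internal shape of an oformula beyond the connective it
-- introduces, so applying a connective-preserving map of formulas to every
-- pool of a proof tree yields again a proof tree, with the same rules and the
-- same structures. A substitution preserves the connectives; for the defined
-- negation this needs ¬ᶠ to be involutive, because σ(¬P) is ¬ᶠ (σ P).
module Submission where

open import Defs
open import Data.Vec using (Vec; []; _∷_; _++_; map)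
open import Data.Vec.Properties using (map-++)
open import Relation.Binary.PropositionalEquality using (_≡_; refl; sym; cong; cong₂; subst)

¬ᶠ-involutive : ∀ F → ¬ᶠ (¬ᶠ F) ≡ F
¬ᶠ-involutive (atom P)  = refl
¬ᶠ-involutive (natom P) = refl
¬ᶠ-involutive (F ∧ᶠ G)  = cong₂ _∧ᶠ_ (¬ᶠ-involutive F) (¬ᶠ-involutive G)
¬ᶠ-involutive (F ∨ᶠ G)  = cong₂ _∨ᶠ_ (¬ᶠ-involutive F) (¬ᶠ-involutive G)

record PreservesConnectives (f : Formula → Formula) : Set where
  field
    preserves-¬ : ∀ F → f (¬ᶠ F) ≡ ¬ᶠ (f F)
    preserves-∧ : ∀ F G → f (F ∧ᶠ G) ≡ f F ∧ᶠ f G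
    preserves-∨ : ∀ F G → f (F ∨ᶠ G) ≡ f F ∨ᶠ f G

subF-¬ᶠ : ∀ σ F → subF σ (¬ᶠ F) ≡ ¬ᶠ (subF σ F)
subF-¬ᶠ σ (atom P)  = refl
subF-¬ᶠ σ (natom P) = sym (¬ᶠ-involutive (σ P))
subF-¬ᶠ σ (F ∧ᶠ G)  = cong₂ _∨ᶠ_ (subF-¬ᶠ σ F) (subF-¬ᶠ σ G)
subF-¬ᶠ σ (F ∨ᶠ G)  = cong₂ _∧ᶠ_ (subF-¬ᶠ σ F) (subF-¬ᶠ σ G)

subF-preservesConnectives : ∀ σ → PreservesConnectives (subF σ)
subF-preservesConnectives σ = record
  { preserves-¬ = subF-¬ᶠ σ
  ; preserves-∧ = λ _ _ → refl
  ; preserves-∨ = λ _ _ → refl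
  }

module _ {S : Rule → Set} {f : Formula → Formula} (hom : PreservesConnectives f) where
  open PreservesConnectives hom

  private
    repool : ∀ {k Γs} {pool pool′ : Vec Formula k} →
             pool ≡ pool′ → Proves S k Γs pool → Proves S k Γs pool′
    repool = subst (Proves S _ _)

    distribute : ∀ {m n Γs} (xs : Vec Formula m) (ys : Vec Formula n) →
                 Proves S _ Γs (map f (xs ++ ys)) → Proves S _ Γs (map f xs ++ map f ys)
    distribute xs ys = repool (map-++ f xs ys)

    collect : ∀ {m n Γs} (xs : Vec Formula m) (ys : Vec Formula n) →
              Proves S _ Γs (map f xs ++ map f ys) → Proves S _ Γs (map f (xs ++ ys))
    collect xs ys = repool (sym (map-++ f xs ys))

    collect-at : ∀ {m n Γs} (xs : Vec Formula m) {H H′ : Formula} (ys : Vec Formula n) →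
                 f H ≡ H′ →
                 Proves S _ Γs (map f xs ++ H′ ∷ map f ys) → Proves S _ Γs (map f (xs ++ H ∷ ys))
    collect-at xs ys refl = collect xs (_ ∷ ys)

  Proves-map : ∀ {k Γs pool} → Proves S k Γs pool → Proves S k Γs (map f pool)
  Proves-map (axEmpty a) = axEmpty a
  Proves-map (axLEM a F) =
    repool (cong (λ ¬F → ¬F ∷ f F ∷ []) (sym (preserves-¬ F))) (axLEM a (f F))
  Proves-map (mix a {Fs = Fs} {Gs} p q) = collect Fs Gs (mix a (Proves-map p) (Proves-map q))
  Proves-map (exchF a m xs F G ys p) =
    collect xs (G ∷ F ∷ ys)
      (exchF a m (map f xs) (f F) (f G) (map f ys) (distribute xs (F ∷ G ∷ ys) (Proves-map p)))
  Proves-map (exchG a Γs Γ Δ Δs p) = exchG a Γs Γ Δ Δs (Proves-map p)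
  Proves-map (weakG a Γs Γ Δs i p) = weakG a Γs Γ Δs i (Proves-map p)
  Proves-map (weakF a m xs H ys p) =
    collect xs (H ∷ ys)
      (weakF a m (map f xs) (f H) (map f ys) (distribute xs ys (Proves-map p)))
  Proves-map (dup a Γs Γ Δs p) = dup a Γs Γ Δs (Proves-map p)
  Proves-map (undup a Γs Γ Δs p) = undup a Γs Γ Δs (Proves-map p)
  Proves-map (contr a m xs F ys p) =
    collect xs (F ∷ ys)
      (contr a m (map f xs) (f F) (map f ys) (distribute xs (F ∷ F ∷ ys) (Proves-map p)))
  Proves-map (orR a m xs F G ys p) =
    collect-at xs ys (preserves-∨ F G)
      (orR a m (map f xs) (f F) (f G) (map f ys) (distribute xs (F ∷ G ∷ ys) (Proves-map p)))
  Proves-map (andR a m xs F G ys c p) =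
    collect-at xs ys (preserves-∧ F G)
      (andR a m (map f xs) (f F) (f G) (map f ys) c (distribute xs (F ∷ G ∷ ys) (Proves-map p)))

lemma7p1 : (S : Rule → Set) (C : Cirquent) → Provable S C →
    (σ : Substitution) → Provable S (subC σ C)
lemma7p1 S (cirq k Γs pool) p σ = Proves-map (subF-preservesConnectives σ) p
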